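{- Let $\mathbb{C}$ be a small category in which every morphism is an epimorphism and which has pairings. If presheaves $P,Q$ on $\mathbb{C}$ both have supports, then the product presheaf $P\times Q$ has supports.
   Context: For a presheaf $P$ write $x\cdot f := P(f)(x)$; $P\times Q$ is the pointwise product, $(x,y)\cdot f = (x\cdot f, y\cdot f)$. A representable factorisation of $x\in P(X)$ is $(Y,q,y)$ with $q\colon X\to Y$ in $\mathbb{C}$, $y\in P(Y)$, $x = y\cdot q$; a morphism $(Y,q,y)\to(Y',q',y')$ is a (necessarily unique) $r\colon Y\to Y'$ with $r\circ q = q'$ and $y'\cdot r = y$; a support for $x$ is a terminal object of this preorder; $P$ has supports if every element of every $P(X)$ has a support. A pair factorisation of a span $Y\xleftarrow{f}X\xrightarrow{g}Z$ is $(X',q',f',g')$ with $q'\colon X\to X'$, $f'\colon X'\to Y$, $g'\colon X'\to Z$, $f'\circ q'=f$, $g'\circ q'=g$; a morphism to $(X'',q'',f'',g'')$ is $r\colon X'\to X''$ with $r\circ q' = q''$, $f''\circ r = f'$, $g''\circ r=g'$; a pairing is a terminal pair factorisation; $\mathbb{C}$ has pairings if every span has one. -}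

module Defs where

open import Level using (Level; _⊔_; suc)
open import Data.Product using (Σ; Σ-syntax; _×_; _,_; proj₁; proj₂)
open import Relation.Binary.PropositionalEquality using (_≡_; cong; cong₂)

record Category (o h : Level) : Set (suc (o ⊔ h)) where
  infixr 9 _∘_
  field
    Obj   : Set o
    Hom   : Obj → Obj → Set h
    id    : ∀ {A} → Hom A A
    _∘_   : ∀ {A B C} → Hom B C → Hom A B → Hom A C
    identityˡ : ∀ {A B} {f : Hom A B} → id ∘ f ≡ f
    identityʳ : ∀ {A B} {f : Hom A B} → f ∘ id ≡ f
    assoc     : ∀ {A B C D} {f : Hom A B} {g : Hom B C} {k : Hom C D} →
                (k ∘ g) ∘ f ≡ k ∘ (g ∘ f)

module _ {o h : Level} (C : Category o h) where
  open Category C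

  IsEpi : ∀ {X Y} → Hom X Y → Set (o ⊔ h)
  IsEpi {X} {Y} f = ∀ {Z} (g k : Hom Y Z) → g ∘ f ≡ k ∘ f → g ≡ k

  AllEpi : Set (o ⊔ h)
  AllEpi = ∀ {X Y} (f : Hom X Y) → IsEpi f

  -- Presheaf on C (a functor C^op → Set p), written with right action x · f = P(f)(x)
  record Presheaf (p : Level) : Set (o ⊔ h ⊔ suc p) where
    infixl 8 _·_
    field
      F     : Obj → Set p
      _·_   : ∀ {X Y} → F Y → Hom X Y → F X
      ·-id  : ∀ {X} (x : F X) → x · id ≡ x
      ·-∘   : ∀ {X Y Z} (x : F Z) (g : Hom Y Z) (f : Hom X Y) →
              x · (g ∘ f) ≡ (x · g) · f

  _×P_ : ∀ {p q} → Presheaf p → Presheaf q → Presheaf (p ⊔ q)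
  P ×P Q = record
    { F    = λ X → P.F X × Q.F X
    ; _·_  = λ { (x , y) f → (x P.· f , y Q.· f) }
    ; ·-id = λ { (x , y) → cong₂ _,_ (P.·-id x) (Q.·-id y) }
    ; ·-∘  = λ { (x , y) g f → cong₂ _,_ (P.·-∘ x g f) (Q.·-∘ y g f) }
    }
    where
      module P = Presheaf P
      module Q = Presheaf Q

  module _ {p : Level} (P : Presheaf p) where
    open Presheaf P

    record RepFact {X : Obj} (x : F X) : Set (o ⊔ h ⊔ p) where
      constructor repFact
      field
        Y   : Obj
        q   : Hom X Y
        y   : F Y
        fac : x ≡ y · q

    RepFactHom : ∀ {X} {x : F X} → RepFact x → RepFact x → Set (h ⊔ p)
    RepFactHom a b = Σ[ r ∈ Hom (RepFact.Y a) (RepFact.Y b) ]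
      ((r ∘ RepFact.q a ≡ RepFact.q b) × (RepFact.y b · r ≡ RepFact.y a))

    IsSupport : ∀ {X} {x : F X} → RepFact x → Set (o ⊔ h ⊔ p)
    IsSupport s = ∀ a → Σ[ m ∈ RepFactHom a s ]
                          (∀ (m' : RepFactHom a s) → proj₁ m' ≡ proj₁ m)

    HasSupports : Set (o ⊔ h ⊔ p)
    HasSupports = ∀ {X} (x : F X) → Σ[ s ∈ RepFact x ] IsSupport s

  record PairFact {X Y Z : Obj} (f : Hom X Y) (g : Hom X Z) : Set (o ⊔ h) where
    constructor pairFact
    field
      X'  : Obj
      q'  : Hom X X'
      f'  : Hom X' Y
      g'  : Hom X' Z
      f-fac : f' ∘ q' ≡ f
      g-fac : g' ∘ q' ≡ g

  PairFactHom : ∀ {X Y Z} {f : Hom X Y} {g : Hom X Z} →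
                PairFact f g → PairFact f g → Set h
  PairFactHom a b = Σ[ r ∈ Hom (PairFact.X' a) (PairFact.X' b) ]
    ((r ∘ PairFact.q' a ≡ PairFact.q' b) ×
     (PairFact.f' b ∘ r ≡ PairFact.f' a) ×
     (PairFact.g' b ∘ r ≡ PairFact.g' a))

  IsPairing : ∀ {X Y Z} {f : Hom X Y} {g : Hom X Z} → PairFact f g → Set (o ⊔ h)
  IsPairing t = ∀ a → Σ[ m ∈ PairFactHom a t ]
                        (∀ (m' : PairFactHom a t) → proj₁ m' ≡ proj₁ m)

  HasPairings : Set (o ⊔ h)
  HasPairings = ∀ {X Y Z} (f : Hom X Y) (g : Hom X Z) →
                Σ[ t ∈ PairFact f g ] IsPairing t

-- In a category of epimorphisms every morphism of factorisations is unique
-- (r ∘ q = q' determines r), so a support is just a factorisation through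
-- which every other one factors.  Given supports (Y₁ , q₁ , y₁) of x and
-- (Y₂ , q₂ , y₂) of y, pair the span Y₁ ← X → Y₂ to (X' , q' , f' , g'); then
-- (X' , q' , (y₁ · f' , y₂ · g')) factorises (x , y).  A factorisation
-- (Z , k , (a , b)) maps to both supports, giving a pair factorisation through
-- Z, and the pairing's mediating map Z → X' is the required morphism.
module Submission where

open import Level using (Level)
open import Data.Product using (_,_; proj₁; proj₂)
open import Relation.Binary.PropositionalEquality
open ≡-Reasoning

open import Defs

module _ {o h : Level} (C : Category o h) where
  open Category C

  module _ {p : Level} (P : Presheaf C p) where
    open Presheaf P
    open RepFact

    refactor : ∀ {X X'} {x : F X} (s : RepFact C P x)
               (q' : Hom X X') (f : Hom X' (Y s)) → f ∘ q' ≡ q s → RepFact C P x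
    refactor {x = x} (repFact _ q y fac) q' f f∘q'≡q = repFact _ q' (y · f) (begin
      x            ≡⟨ fac ⟩
      y · q        ≡⟨ cong (y ·_) (sym f∘q'≡q) ⟩
      y · (f ∘ q') ≡⟨ ·-∘ y f q' ⟩
      y · f · q'   ∎)

    refactorHom : ∀ {X X'} {x : F X} {a s : RepFact C P x} (m : RepFactHom C P a s)
                  {q' : Hom X X'} {f : Hom X' (Y s)} (f∘q'≡q : f ∘ q' ≡ q s)
                  (r : Hom (Y a) X') → r ∘ q a ≡ q' → f ∘ r ≡ proj₁ m →
                  RepFactHom C P a (refactor s q' f f∘q'≡q)
    refactorHom {a = a} {s} (m , _ , y·m≡y) {f = f} _ r r∘q≡q' f∘r≡m = r , r∘q≡q' , (begin
      y s · f · r   ≡⟨ sym (·-∘ (y s) f r) ⟩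
      y s · (f ∘ r) ≡⟨ cong (y s ·_) f∘r≡m ⟩
      y s · m       ≡⟨ y·m≡y ⟩
      y a           ∎)

    RepFactHom-unique : AllEpi C → ∀ {X} {x : F X} {a s : RepFact C P x}
                        (m m' : RepFactHom C P a s) → proj₁ m ≡ proj₁ m'
    RepFactHom-unique epi {a = a} (m , m∘q≡ , _) (m' , m'∘q≡ , _) =
      epi (q a) m m' (trans m∘q≡ (sym m'∘q≡))

    weaklyTerminal⇒isSupport : AllEpi C → ∀ {X} {x : F X} (s : RepFact C P x) →
                               (∀ a → RepFactHom C P a s) → IsSupport C P s
    weaklyTerminal⇒isSupport epi s into a =
      into a , λ m' → RepFactHom-unique epi {a = a} {s} m' (into a)

  module _ {ℓp ℓq : Level} {P : Presheaf C ℓp} {Q : Presheaf C ℓq} where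
    private
      module P = Presheaf P
      module Q = Presheaf Q
    open RepFact using (q; fac)

    RepFact-proj₁ : ∀ {X} {x : P.F X} {y : Q.F X} →
                    RepFact C (_×P_ C P Q) (x , y) → RepFact C P x
    RepFact-proj₁ (repFact Z k (a , _) fac) = repFact Z k a (cong proj₁ fac)

    RepFact-proj₂ : ∀ {X} {x : P.F X} {y : Q.F X} →
                    RepFact C (_×P_ C P Q) (x , y) → RepFact C Q y
    RepFact-proj₂ (repFact Z k (_ , b) fac) = repFact Z k b (cong proj₂ fac)

    module _ {X} {x : P.F X} {y : Q.F X}
             (s₁ : RepFact C P x) (s₂ : RepFact C Q y)
             (t : PairFact C (q s₁) (q s₂)) where
      open PairFact t

      RepFact-× : RepFact C (_×P_ C P Q) (x , y)
      RepFact-× = repFact X' q' (RepFact.y sP , RepFact.y sQ) (cong₂ _,_ (fac sP) (fac sQ))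
        where
          sP = refactor P s₁ q' f' f-fac
          sQ = refactor Q s₂ q' g' g-fac

      RepFact-×-isSupport : AllEpi C → IsSupport C P s₁ → IsSupport C Q s₂ →
                            IsPairing C t → IsSupport C (_×P_ C P Q) RepFact-×
      RepFact-×-isSupport epi supp₁ supp₂ pairing =
        weaklyTerminal⇒isSupport (_×P_ C P Q) epi RepFact-× into
        where
          into : ∀ a → RepFactHom C (_×P_ C P Q) a RepFact-×
          into a@(repFact Z k _ _) =
            let m₁@(r₁ , r₁∘k≡q₁ , _) = proj₁ (supp₁ (RepFact-proj₁ a))
                m₂@(r₂ , r₂∘k≡q₂ , _) = proj₁ (supp₂ (RepFact-proj₂ a))
                (r , r∘k≡q' , f'∘r≡r₁ , g'∘r≡r₂) =
                  proj₁ (pairing (pairFact Z k r₁ r₂ r₁∘k≡q₁ r₂∘k≡q₂))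
                (_ , _ , yP) = refactorHom P {a = RepFact-proj₁ a} {s₁} m₁ f-fac r r∘k≡q' f'∘r≡r₁
                (_ , _ , yQ) = refactorHom Q {a = RepFact-proj₂ a} {s₂} m₂ g-fac r r∘k≡q' g'∘r≡r₂
            in r , r∘k≡q' , cong₂ _,_ yP yQ

proposition7p4 : ∀ {o h p q : Level} (C : Category o h) →
    AllEpi C → HasPairings C →
    (P : Presheaf C p) (Q : Presheaf C q) →
    HasSupports C P → HasSupports C Q →
    HasSupports C (_×P_ C P Q)
proposition7p4 C epi pairings P Q supportsP supportsQ (x , y) =
  let (s₁ , supp₁) = supportsP x
      (s₂ , supp₂) = supportsQ y
      (t , pairing) = pairings (RepFact.q s₁) (RepFact.q s₂)
  in RepFact-× C s₁ s₂ t , RepFact-×-isSupport C s₁ s₂ t epi supp₁ supp₂ pairing
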